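{- Let $n\ge 4$, $N=\{1,\dots,n\}$, let $i_1,i_2\in N$ with $i_1\ne i_2$, and let $\hat N^c=N\setminus\{i_1,i_2\}$. Then the inequality $$\sum_{j\in\hat N^c}\left(x_{i_1j}+x_{ji_1}+x_{ji_2}\right)-x_{i_1i_2}-\sum_{j,j'\in\hat N^c:\ j\ne j'} x_{jj'}\ \le\ 3-\frac{(n-4)(n-5)}{2}$$ is a valid inequality for the weak order polytope $P^n_{WO}$.
   Context: Let $N=\{1,\dots,n\}$ and $A_N=\{(i,j): i,j\in N,\ i\ne j\}$. A weak order on $N$ is a binary relation $W\subseteq N\times N$ that is reflexive, transitive and total; $(i,j)\in W$ is read "$i$ is preferred over or tied with $j$". The characteristic vector of $W$ is $x^W\in\{0,1\}^{A_N}$ with $x^W_{ij}=1$ if $(i,j)\in W$ and $0$ otherwise. The weak order polytope $P^n_{WO}\subseteq\mathbb{R}^{A_N}$ is the convex hull of the characteristic vectors of all weak orders on $N$. An inequality $\pi x\le\pi_0$ is valid for $P$ if it holds for every $x\in P$.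
   Formalization: Points of the weak order polytope $P^n_{WO}$ have rational coordinates and are rational convex combinations of the characteristic vectors, rather than arbitrary real points of $\mathbb{R}^{A_N}$. -}

module Defs where

open import Data.Bool using (Bool; true; false; if_then_else_)
open import Data.Nat using (ℕ; zero; suc)
open import Data.Fin using (Fin; _≟_) renaming (zero to fz; suc to fs)
open import Data.Integer using (ℤ; +_) renaming (_-_ to _-ℤ_; _*_ to _*ℤ_)
open import Data.Rational using (ℚ; 0ℚ; 1ℚ; _+_; _*_; _-_; _≤_; _/_)
open import Data.List using (List; []; _∷_)
open import Data.Product using (Σ; _×_; _,_)
open import Data.Sum using (_⊎_)
open import Relation.Binary.PropositionalEquality using (_≡_; _≢_)
open import Relation.Nullary using (¬_)
open import Relation.Nullary.Decidable using (⌊_⌋)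

-- A binary relation on Fin n, given by its (decidable) indicator:
-- W i j ≡ true  means (i , j) ∈ W.
Rel₂ : ℕ → Set
Rel₂ n = Fin n → Fin n → Bool

record IsWeakOrder {n : ℕ} (W : Rel₂ n) : Set where
  field
    reflexive  : ∀ i → W i i ≡ true
    transitive : ∀ i j k → W i j ≡ true → W j k ≡ true → W i k ≡ true
    total      : ∀ i j → (W i j ≡ true) ⊎ (W j i ≡ true)

WeakOrder : ℕ → Set
WeakOrder n = Σ (Rel₂ n) IsWeakOrder

-- Points of ℚ^{A_N}: functions on ordered pairs (diagonal entries are
-- ignored everywhere; only coordinates (i , j) with i ≢ j matter).
Point : ℕ → Set
Point n = Fin n → Fin n → ℚ

charVec : ∀ {n} → WeakOrder n → Point n
charVec (W , _) i j = if W i j then 1ℚ else 0ℚ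

-- Convex combinations: a finite list of (coefficient , weak order).
sumCoeffs : ∀ {n} → List (ℚ × WeakOrder n) → ℚ
sumCoeffs [] = 0ℚ
sumCoeffs ((l , _) ∷ ts) = l + sumCoeffs ts

combination : ∀ {n} → List (ℚ × WeakOrder n) → Point n
combination [] i j = 0ℚ
combination ((l , W) ∷ ts) i j = l * charVec W i j + combination ts i j

data AllNonneg {n : ℕ} : List (ℚ × WeakOrder n) → Set where
  []  : AllNonneg []
  _∷_ : ∀ {l W ts} → 0ℚ ≤ l → AllNonneg ts → AllNonneg ((l , W) ∷ ts)

-- x ∈ P^n_WO (rational points of the convex hull of the characteristic
-- vectors of weak orders), coordinates indexed by A_N.
InWeakOrderPolytope : ∀ n → Point n → Set
InWeakOrderPolytope n x =
  Σ (List (ℚ × WeakOrder n)) λ ts →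
    AllNonneg ts × (sumCoeffs ts ≡ 1ℚ) ×
    (∀ i j → i ≢ j → x i j ≡ combination ts i j)

ValidFor : ∀ n → (Point n → ℚ) → ℚ → Set
ValidFor n π π₀ = ∀ x → InWeakOrderPolytope n x → π x ≤ π₀

sumFin : ∀ {n} → (Fin n → ℚ) → ℚ
sumFin {zero} f = 0ℚ
sumFin {suc n} f = f fz + sumFin (λ k → f (fs k))

inComp : ∀ {n} → Fin n → Fin n → Fin n → Bool
inComp i₁ i₂ j = if ⌊ j ≟ i₁ ⌋ then false else (if ⌊ j ≟ i₂ ⌋ then false else true)

sumComp : ∀ {n} → Fin n → Fin n → (Fin n → ℚ) → ℚ
sumComp i₁ i₂ f = sumFin (λ j → if inComp i₁ i₂ j then f j else 0ℚ)

lhs7 : ∀ {n} → Fin n → Fin n → Point n → ℚ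
lhs7 i₁ i₂ x =
  sumComp i₁ i₂ (λ j → x i₁ j + x j i₁ + x j i₂)
  - x i₁ i₂
  - sumComp i₁ i₂ (λ j → sumComp i₁ i₂ (λ j' →
        if ⌊ j ≟ j' ⌋ then 0ℚ else x j j'))

-- Right-hand side 3 - (n-4)(n-5)/2 (computed in ℤ, then in ℚ).
rhs7 : ℕ → ℚ
rhs7 n = ((+ 3) / 1) - (((+ n -ℤ + 4) *ℤ (+ n -ℤ + 5)) / 2)

-- Let c = N̂ᶜ, k = |c| = n − 2, and call j ∈ c
-- tight if j is tied with i₁ and weakly above i₂; let s be the number of tight j.
-- Each j ∈ c contributes at most 2 + [j tight] to the first sum, and each unordered pair
-- {j, j'} ⊆ c contributes at least 1 + [j, j' both tight] to the pair sum, by totality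
-- and transitivity. Hence the left-hand side is at most
-- 2k + s − C(k,2) − C(s,2) − x_{i₁i₂}. If s > 0 then i₁ ≽ j ≽ i₂ forces x_{i₁i₂} = 1,
-- and s − C(s,2) ≤ 1 always, so the value is at most 2k − C(k,2) = 3 − (n−4)(n−5)/2.
-- Validity on the polytope follows because the left-hand side is linear and only reads
-- off-diagonal coordinates.
module Submission where

open import Defs
open import Data.Bool using (Bool; true; false; if_then_else_; _∧_)
open import Data.Bool.Properties using (∧-conicalˡ; ∧-conicalʳ)
open import Data.Fin using (Fin; _≟_) renaming (zero to fz; suc to fs)
open import Data.Fin.Properties using (suc-injective)
open import Data.Integer as ℤ using (ℤ)
import Data.Integer.Properties as ℤ
open import Data.List using ([]; _∷_)
open import Data.Nat as ℕ using (ℕ; zero; suc)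
import Data.Nat.Properties as ℕ
open import Data.Product using (_×_; _,_)
open import Data.Rational
  using (ℚ; 0ℚ; 1ℚ; ½; _+_; _*_; _-_; -_; _≤_; _≤?_; _/_; toℚᵘ; nonNegative)
open import Data.Rational.Properties
  using ( ≤-refl; ≤-reflexive; ≤-trans; +-mono-≤; +-monoʳ-≤; neg-antimono-≤
        ; +-identityˡ; +-identityʳ; *-identityˡ; *-zeroˡ; *-zeroʳ; *-distribˡ-+; *-distribʳ-+
        ; *-monoˡ-≤-nonNeg; toℚᵘ-injective; toℚᵘ-fromℚᵘ; toℚᵘ-homo-+
        ; toℚᵘ-homo-*; module ≤-Reasoning)
import Data.Rational.Unnormalised as ℚᵘ
import Data.Rational.Unnormalised.Properties as ℚᵘ
open import Data.Rational.Solver using (module +-*-Solver)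
open import Data.Sum using (_⊎_; inj₁; inj₂)
open import Function using (_∘_)
open import Relation.Binary.PropositionalEquality
open import Relation.Nullary using (yes; no)
open import Relation.Nullary.Decidable using (⌊_⌋; True; toWitness; isYes≗does; dec-false; ⌊⌋-map′)

open +-*-Solver

≤-by-decision : ∀ {p q : ℚ} → True (p ≤? q) → p ≤ q
≤-by-decision {p} {q} = toWitness {a? = p ≤? q}

2ℚ : ℚ
2ℚ = ℤ.+ 2 / 1

𝟙 : Bool → ℚ
𝟙 b = if b then 1ℚ else 0ℚ

0≤𝟙 : ∀ b → 0ℚ ≤ 𝟙 b
0≤𝟙 true  = ≤-by-decision _
0≤𝟙 false = ≤-refl

1≤𝟙 : ∀ {b} → b ≡ true → 1ℚ ≤ 𝟙 b
1≤𝟙 refl = ≤-refl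

𝟙-triple-≤ : ∀ p q r → 𝟙 p + 𝟙 q + 𝟙 r ≤ 2ℚ + 𝟙 (p ∧ q ∧ r)
𝟙-triple-≤ true  true  true  = ≤-by-decision _
𝟙-triple-≤ true  true  false = ≤-by-decision _
𝟙-triple-≤ true  false true  = ≤-by-decision _
𝟙-triple-≤ true  false false = ≤-by-decision _
𝟙-triple-≤ false true  true  = ≤-by-decision _
𝟙-triple-≤ false true  false = ≤-by-decision _
𝟙-triple-≤ false false true  = ≤-by-decision _
𝟙-triple-≤ false false false = ≤-by-decision _

𝟙-pair-≤ : ∀ {b b' u} → b ≡ true ⊎ b' ≡ true → (u ≡ true → b ≡ true × b' ≡ true) →
  1ℚ + 𝟙 u ≤ 𝟙 b + 𝟙 b'
𝟙-pair-≤ {u = true}  _ both with both refl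
... | refl , refl = ≤-refl
𝟙-pair-≤ {true}  {true}  {false} _ _ = ≤-by-decision _
𝟙-pair-≤ {true}  {false} {false} _ _ = ≤-refl
𝟙-pair-≤ {false} {true}  {false} _ _ = ≤-by-decision _
𝟙-pair-≤ {false} {false} {false} (inj₁ ()) _
𝟙-pair-≤ {false} {false} {false} (inj₂ ()) _

sum-difference-≤ : ∀ {a α ρ R A D β : ℚ} → a ≤ α → ρ ≤ R → A - D ≤ β → (a + A) - (R + D) ≤ (α - ρ) + β
sum-difference-≤ {a} {α} {ρ} {R} {A} {D} {β} a≤α ρ≤R A-D≤β = begin
  (a + A) - (R + D) ≡⟨ solve 4 (λ a A R D → (a :+ A) :- (R :+ D) := (a :- R) :+ (A :- D)) refl a A R D ⟩
  (a - R) + (A - D) ≤⟨ +-mono-≤ (+-mono-≤ a≤α (neg-antimono-≤ ρ≤R)) A-D≤β ⟩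
  (α - ρ) + β       ∎
  where open ≤-Reasoning

subtract-≤ : ∀ {A D B f e : ℚ} → A - D ≤ B + f → f ≤ e → (A - e) - D ≤ B
subtract-≤ {A} {D} {B} {f} {e} A-D≤B+f f≤e = begin
  (A - e) - D    ≡⟨ solve 3 (λ A D e → (A :- e) :- D := (A :- D) :+ (:- e)) refl A D e ⟩
  (A - D) + - e  ≤⟨ +-mono-≤ A-D≤B+f (neg-antimono-≤ f≤e) ⟩
  (B + f) + - f  ≡⟨ solve 2 (λ B f → (B :+ f) :+ (:- f) := B) refl B f ⟩
  B              ∎
  where open ≤-Reasoning

fromℤ : ℤ → ℚ
fromℤ z = z / 1

toℚᵘ-/ : ∀ z d → toℚᵘ (z / suc d) ℚᵘ.≃ ℚᵘ.mkℚᵘ z d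
toℚᵘ-/ z d = toℚᵘ-fromℚᵘ (ℚᵘ.mkℚᵘ z d)

fromℤ-+ : ∀ a b → fromℤ (a ℤ.+ b) ≡ fromℤ a + fromℤ b
fromℤ-+ a b = toℚᵘ-injective (begin-equality
  toℚᵘ (fromℤ (a ℤ.+ b))             ≃⟨ toℚᵘ-/ (a ℤ.+ b) 0 ⟩
  ℚᵘ.mkℚᵘ (a ℤ.+ b) 0                ≃⟨ ℚᵘ.*≡* (cong (ℤ._* ℤ.+ 1) (cong₂ ℤ._+_ (sym (ℤ.*-identityʳ a))
                                                                           (sym (ℤ.*-identityʳ b)))) ⟩
  ℚᵘ.mkℚᵘ a 0 ℚᵘ.+ ℚᵘ.mkℚᵘ b 0      ≃⟨ ℚᵘ.+-cong (toℚᵘ-/ a 0) (toℚᵘ-/ b 0) ⟨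
  toℚᵘ (fromℤ a) ℚᵘ.+ toℚᵘ (fromℤ b) ≃⟨ toℚᵘ-homo-+ (fromℤ a) (fromℤ b) ⟨
  toℚᵘ (fromℤ a + fromℤ b)           ∎)
  where open ℚᵘ.≤-Reasoning

fromℤ-* : ∀ a b → fromℤ (a ℤ.* b) ≡ fromℤ a * fromℤ b
fromℤ-* a b = toℚᵘ-injective (begin-equality
  toℚᵘ (fromℤ (a ℤ.* b))             ≃⟨ toℚᵘ-/ (a ℤ.* b) 0 ⟩
  ℚᵘ.mkℚᵘ a 0 ℚᵘ.* ℚᵘ.mkℚᵘ b 0      ≃⟨ ℚᵘ.*-cong (toℚᵘ-/ a 0) (toℚᵘ-/ b 0) ⟨
  toℚᵘ (fromℤ a) ℚᵘ.* toℚᵘ (fromℤ b) ≃⟨ toℚᵘ-homo-* (fromℤ a) (fromℤ b) ⟨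
  toℚᵘ (fromℤ a * fromℤ b)           ∎)
  where open ℚᵘ.≤-Reasoning

/2≡fromℤ*½ : ∀ z → z / 2 ≡ fromℤ z * ½
/2≡fromℤ*½ z = toℚᵘ-injective (begin-equality
  toℚᵘ (z / 2)                       ≃⟨ toℚᵘ-/ z 1 ⟩
  ℚᵘ.mkℚᵘ z 1                        ≃⟨ ℚᵘ.*≡* (cong (ℤ._* ℤ.+ 2) (sym (ℤ.*-identityʳ z))) ⟩
  ℚᵘ.mkℚᵘ z 0 ℚᵘ.* toℚᵘ ½            ≃⟨ ℚᵘ.*-congʳ (toℚᵘ-/ z 0) ⟨
  toℚᵘ (fromℤ z) ℚᵘ.* toℚᵘ ½         ≃⟨ toℚᵘ-homo-* (fromℤ z) ½ ⟨
  toℚᵘ (fromℤ z * ½)                 ∎)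
  where open ℚᵘ.≤-Reasoning

fromℕ : ℕ → ℚ
fromℕ k = fromℤ (ℤ.+ k)

fromℕ-+ : ∀ j k → fromℕ (j ℕ.+ k) ≡ fromℕ j + fromℕ k
fromℕ-+ j k = fromℤ-+ (ℤ.+ j) (ℤ.+ k)

fromℕ-suc : ∀ k → fromℕ (suc k) ≡ 1ℚ + fromℕ k
fromℕ-suc = fromℕ-+ 1

0≤fromℕ : ∀ k → 0ℚ ≤ fromℕ k
0≤fromℕ zero = ≤-refl
0≤fromℕ (suc k) = subst (0ℚ ≤_) (sym (fromℕ-suc k)) (+-mono-≤ (≤-by-decision {0ℚ} {1ℚ} _) (0≤fromℕ k))

excess : ℕ → ℚ
excess k = fromℕ k - fromℕ k * (fromℕ k - 1ℚ) * ½

excess-suc : ∀ k → excess (suc k) ≡ excess k + 1ℚ - fromℕ k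
excess-suc k = begin
  excess (suc k)
    ≡⟨ cong (λ K → K - K * (K - 1ℚ) * ½) (fromℕ-suc k) ⟩
  (1ℚ + fromℕ k) - (1ℚ + fromℕ k) * ((1ℚ + fromℕ k) - 1ℚ) * ½
    ≡⟨ solve 1 (λ K → (con 1ℚ :+ K) :- (con 1ℚ :+ K) :* ((con 1ℚ :+ K) :- con 1ℚ) :* con ½
                    := (K :- K :* (K :- con 1ℚ) :* con ½) :+ con 1ℚ :- K) refl (fromℕ k) ⟩
  excess k + 1ℚ - fromℕ k ∎
  where open ≡-Reasoning

excess-≤-1 : ∀ s → excess s ≤ 1ℚ
excess-≤-1 zero = ≤-by-decision _
excess-≤-1 (suc zero) = ≤-refl
excess-≤-1 (suc (suc s)) = begin
  excess (suc (suc s))                ≡⟨ excess-suc (suc s) ⟩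
  excess (suc s) + 1ℚ - fromℕ (suc s) ≡⟨ cong (λ S → excess (suc s) + 1ℚ - S) (fromℕ-suc s) ⟩
  excess (suc s) + 1ℚ - (1ℚ + fromℕ s)
    ≡⟨ solve 2 (λ e S → e :+ con 1ℚ :- (con 1ℚ :+ S) := e :+ (:- S)) refl (excess (suc s)) (fromℕ s) ⟩
  excess (suc s) + - fromℕ s          ≤⟨ +-monoʳ-≤ (excess (suc s)) (neg-antimono-≤ (0≤fromℕ s)) ⟩
  excess (suc s) + - 0ℚ               ≡⟨ +-identityʳ (excess (suc s)) ⟩
  excess (suc s)                      ≤⟨ excess-≤-1 (suc s) ⟩
  1ℚ                                  ∎
  where open ≤-Reasoning

rhs7-closed-form : ∀ k → rhs7 (2 ℕ.+ k) ≡ fromℕ k + excess k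
rhs7-closed-form k = begin
  rhs7 (2 ℕ.+ k)
    ≡⟨ cong (λ z → fromℤ (ℤ.+ 3) - z) (trans (/2≡fromℤ*½ (A ℤ.* B)) (cong (_* ½) (fromℤ-* A B))) ⟩
  fromℤ (ℤ.+ 3) - fromℤ A * fromℤ B * ½
    ≡⟨ cong₂ (λ a b → fromℤ (ℤ.+ 3) - a * b * ½) (shift 4) (shift 5) ⟩
  fromℤ (ℤ.+ 3) - (fromℕ 2 + K + fromℤ (ℤ.- ℤ.+ 4)) * (fromℕ 2 + K + fromℤ (ℤ.- ℤ.+ 5)) * ½
    ≡⟨ solve 1 (λ K → con (fromℤ (ℤ.+ 3))
                        :- (con (fromℕ 2) :+ K :+ con (fromℤ (ℤ.- ℤ.+ 4)))
                           :* (con (fromℕ 2) :+ K :+ con (fromℤ (ℤ.- ℤ.+ 5))) :* con ½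
                      := K :+ (K :- K :* (K :- con 1ℚ) :* con ½)) refl K ⟩
  K + excess k ∎
  where
  open ≡-Reasoning
  K : ℚ
  K = fromℕ k
  A B : ℤ
  A = ℤ.+ (2 ℕ.+ k) ℤ.- ℤ.+ 4
  B = ℤ.+ (2 ℕ.+ k) ℤ.- ℤ.+ 5
  shift : ∀ d → fromℤ (ℤ.+ (2 ℕ.+ k) ℤ.- ℤ.+ d) ≡ fromℕ 2 + K + fromℤ (ℤ.- ℤ.+ d)
  shift d = trans (fromℤ-+ (ℤ.+ (2 ℕ.+ k)) (ℤ.- ℤ.+ d)) (cong (_+ fromℤ (ℤ.- ℤ.+ d)) (fromℕ-+ 2 k))

count : ∀ {m} → (Fin m → Bool) → ℕ
count {zero}  f = 0
count {suc m} f = (if f fz then 1 else 0) ℕ.+ count (f ∘ fs)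

count-cong : ∀ {m} {f g : Fin m → Bool} → (∀ j → f j ≡ g j) → count f ≡ count g
count-cong {zero}  f≗g = refl
count-cong {suc m} f≗g = cong₂ (λ b r → (if b then 1 else 0) ℕ.+ r) (f≗g fz) (count-cong (f≗g ∘ fs))

count-true : ∀ m → count {m} (λ _ → true) ≡ m
count-true zero    = refl
count-true (suc m) = cong suc (count-true m)

⌊fs≟fs⌋ : ∀ {m} (k k' : Fin m) → ⌊ fs k ≟ fs k' ⌋ ≡ ⌊ k ≟ k' ⌋
⌊fs≟fs⌋ k k' = ⌊⌋-map′ (cong fs) suc-injective (k ≟ k')

count-remove : ∀ {m} (a : Fin m) (f : Fin m → Bool) →
  count f ≡ (if f a then 1 else 0) ℕ.+ count (λ j → if ⌊ j ≟ a ⌋ then false else f j)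
count-remove fz     f = refl
count-remove {suc m} (fs a) f = begin
  F₀ ℕ.+ count (f ∘ fs)         ≡⟨ cong (F₀ ℕ.+_) (count-remove a (f ∘ fs)) ⟩
  F₀ ℕ.+ (Fₐ ℕ.+ count rest)    ≡⟨ ℕ.+-assoc F₀ Fₐ (count rest) ⟨
  (F₀ ℕ.+ Fₐ) ℕ.+ count rest    ≡⟨ cong (ℕ._+ count rest) (ℕ.+-comm F₀ Fₐ) ⟩
  (Fₐ ℕ.+ F₀) ℕ.+ count rest    ≡⟨ ℕ.+-assoc Fₐ F₀ (count rest) ⟩
  Fₐ ℕ.+ (F₀ ℕ.+ count rest)    ≡⟨ cong (λ r → Fₐ ℕ.+ (F₀ ℕ.+ r)) (count-cong shift) ⟩
  Fₐ ℕ.+ (F₀ ℕ.+ count (λ k → if ⌊ fs k ≟ fs a ⌋ then false else f (fs k))) ∎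
  where
  open ≡-Reasoning
  F₀ Fₐ : ℕ
  F₀ = if f fz then 1 else 0
  Fₐ = if f (fs a) then 1 else 0
  rest : Fin m → Bool
  rest k = if ⌊ k ≟ a ⌋ then false else f (fs k)
  shift : ∀ k → rest k ≡ (if ⌊ fs k ≟ fs a ⌋ then false else f (fs k))
  shift k = cong (λ b → if b then false else f (fs k)) (sym (⌊fs≟fs⌋ k a))

count-inComp : ∀ {n} (i₁ i₂ : Fin n) → i₁ ≢ i₂ → 2 ℕ.+ count (inComp i₁ i₂) ≡ n
count-inComp {n} i₁ i₂ i₁≢i₂ = begin
  2 ℕ.+ count (inComp i₁ i₂)                 ≡⟨ cong (λ b → suc ((if b then 1 else 0) ℕ.+ count (inComp i₁ i₂))) i₁∉ ⟨
  suc ((if notI₂ i₁ then 1 else 0) ℕ.+ count (inComp i₁ i₂)) ≡⟨ cong suc (count-remove i₁ notI₂) ⟨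
  suc (count notI₂)                          ≡⟨ count-remove i₂ (λ _ → true) ⟨
  count {n} (λ _ → true)                     ≡⟨ count-true n ⟩
  n                                          ∎
  where
  open ≡-Reasoning
  notI₂ : Fin n → Bool
  notI₂ j = if ⌊ j ≟ i₂ ⌋ then false else true
  i₁∉ : notI₂ i₁ ≡ true
  i₁∉ = cong (λ b → if b then false else true) (trans (isYes≗does (i₁ ≟ i₂)) (dec-false (i₁ ≟ i₂) i₁≢i₂))

excess-count-≤ : ∀ {m} (f : Fin m → Bool) {e : ℚ} → 0ℚ ≤ e → (∀ j → f j ≡ true → 1ℚ ≤ e) →
  excess (count f) ≤ e
excess-count-≤ {zero}  f 0≤e _ = 0≤e
excess-count-≤ {suc m} f 0≤e 1≤e with f fz in f₀
... | true  = ≤-trans (excess-≤-1 (suc (count (f ∘ fs)))) (1≤e fz f₀)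
... | false = excess-count-≤ (f ∘ fs) 0≤e (1≤e ∘ fs)

sumFin-cong : ∀ {m} {f g : Fin m → ℚ} → (∀ j → f j ≡ g j) → sumFin f ≡ sumFin g
sumFin-cong {zero}  f≗g = refl
sumFin-cong {suc m} f≗g = cong₂ _+_ (f≗g fz) (sumFin-cong (f≗g ∘ fs))

sumFin-mono : ∀ {m} {f g : Fin m → ℚ} → (∀ j → f j ≤ g j) → sumFin f ≤ sumFin g
sumFin-mono {zero}  f≤g = ≤-refl
sumFin-mono {suc m} f≤g = +-mono-≤ (f≤g fz) (sumFin-mono (f≤g ∘ fs))

sumFin-+ : ∀ {m} (f g : Fin m → ℚ) → sumFin (λ j → f j + g j) ≡ sumFin f + sumFin g
sumFin-+ {zero}  f g = refl
sumFin-+ {suc m} f g = begin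
  (f fz + g fz) + sumFin (λ j → f (fs j) + g (fs j))
    ≡⟨ cong ((f fz + g fz) +_) (sumFin-+ (f ∘ fs) (g ∘ fs)) ⟩
  (f fz + g fz) + (sumFin (f ∘ fs) + sumFin (g ∘ fs))
    ≡⟨ solve 4 (λ a b A B → (a :+ b) :+ (A :+ B) := (a :+ A) :+ (b :+ B)) refl (f fz) (g fz) (sumFin (f ∘ fs)) (sumFin (g ∘ fs)) ⟩
  (f fz + sumFin (f ∘ fs)) + (g fz + sumFin (g ∘ fs)) ∎
  where open ≡-Reasoning

sumFin-*ˡ : ∀ {m} l (f : Fin m → ℚ) → sumFin (λ j → l * f j) ≡ l * sumFin f
sumFin-*ˡ {zero}  l f = sym (*-zeroʳ l)
sumFin-*ˡ {suc m} l f =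
  trans (cong (l * f fz +_) (sumFin-*ˡ l (f ∘ fs))) (sym (*-distribˡ-+ l (f fz) (sumFin (f ∘ fs))))

sumFin-𝟙 : ∀ {m} (f : Fin m → Bool) → sumFin (λ j → 𝟙 (f j)) ≡ fromℕ (count f)
sumFin-𝟙 {zero}  f = refl
sumFin-𝟙 {suc m} f = begin
  𝟙 (f fz) + sumFin (λ j → 𝟙 (f (fs j)))    ≡⟨ cong₂ _+_ (𝟙≡fromℕ (f fz)) (sumFin-𝟙 (f ∘ fs)) ⟩
  fromℕ (if f fz then 1 else 0) + fromℕ (count (f ∘ fs)) ≡⟨ fromℕ-+ (if f fz then 1 else 0) (count (f ∘ fs)) ⟨
  fromℕ (count f)                            ∎
  where
  open ≡-Reasoning
  𝟙≡fromℕ : ∀ b → 𝟙 b ≡ fromℕ (if b then 1 else 0)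
  𝟙≡fromℕ true  = refl
  𝟙≡fromℕ false = refl

maskedSum : ∀ {m} → (Fin m → Bool) → (Fin m → ℚ) → ℚ
maskedSum c f = sumFin (λ j → if c j then f j else 0ℚ)

maskedSum-cong : ∀ {m} (c : Fin m → Bool) {f g : Fin m → ℚ} →
  (∀ j → c j ≡ true → f j ≡ g j) → maskedSum c f ≡ maskedSum c g
maskedSum-cong c f≗g = sumFin-cong λ j → masked (c j) (f≗g j)
  where
  masked : ∀ b {u v} → (b ≡ true → u ≡ v) → (if b then u else 0ℚ) ≡ (if b then v else 0ℚ)
  masked true  u≡v = u≡v refl
  masked false _   = refl

maskedSum-mono : ∀ {m} (c : Fin m → Bool) {f g : Fin m → ℚ} →
  (∀ j → c j ≡ true → f j ≤ g j) → maskedSum c f ≤ maskedSum c g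
maskedSum-mono c f≤g = sumFin-mono λ j → masked (c j) (f≤g j)
  where
  masked : ∀ b {u v} → (b ≡ true → u ≤ v) → (if b then u else 0ℚ) ≤ (if b then v else 0ℚ)
  masked true  u≤v = u≤v refl
  masked false _   = ≤-refl

maskedSum-+ : ∀ {m} (c : Fin m → Bool) (f g : Fin m → ℚ) →
  maskedSum c (λ j → f j + g j) ≡ maskedSum c f + maskedSum c g
maskedSum-+ c f g =
  trans (sumFin-cong λ j → masked (c j) {f j} {g j})
        (sumFin-+ (λ j → if c j then f j else 0ℚ) (λ j → if c j then g j else 0ℚ))
  where
  masked : ∀ b {u v} → (if b then u + v else 0ℚ) ≡ (if b then u else 0ℚ) + (if b then v else 0ℚ)
  masked true  = refl
  masked false = refl

maskedSum-𝟙 : ∀ {m} (c t : Fin m → Bool) →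
  maskedSum c (λ j → 𝟙 (t j)) ≡ fromℕ (count (λ j → c j ∧ t j))
maskedSum-𝟙 c t = trans (sumFin-cong λ j → masked (c j)) (sumFin-𝟙 (λ j → c j ∧ t j))
  where
  masked : ∀ b {b'} → (if b then 𝟙 b' else 0ℚ) ≡ 𝟙 (b ∧ b')
  masked true  = refl
  masked false = refl

offDiagonalSum : ∀ {m} → (Fin m → Bool) → (Fin m → Fin m → ℚ) → ℚ
offDiagonalSum c G = maskedSum c (λ j → maskedSum c (λ j' → if ⌊ j ≟ j' ⌋ then 0ℚ else G j j'))

offDiagonalSum-suc : ∀ {m} (c : Fin (suc m) → Bool) (G : Fin (suc m) → Fin (suc m) → ℚ) →
  offDiagonalSum c G
    ≡ (if c fz then maskedSum (c ∘ fs) (λ k → G fz (fs k) + G (fs k) fz) else 0ℚ)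
      + offDiagonalSum (c ∘ fs) (λ k k' → G (fs k) (fs k'))
offDiagonalSum-suc {m} c G = begin
  offDiagonalSum c G
    ≡⟨ cong (row₀ +_) (maskedSum-cong c' λ k _ → cong ((if c fz then C k else 0ℚ) +_) (shift k)) ⟩
  row₀ + maskedSum c' (λ k → (if c fz then C k else 0ℚ) + inner k)
    ≡⟨ regroup (c fz) ⟩
  (if c fz then maskedSum c' (λ k → G fz (fs k) + C k) else 0ℚ) + offDiagonalSum c' G' ∎
  where
  open ≡-Reasoning
  c' : Fin m → Bool
  c' = c ∘ fs
  G' : Fin m → Fin m → ℚ
  G' k k' = G (fs k) (fs k')
  R : ℚ
  R = maskedSum c' (λ k → G fz (fs k))
  C : Fin m → ℚ
  C k = G (fs k) fz
  row₀ : ℚ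
  row₀ = if c fz then (if c fz then 0ℚ else 0ℚ) + R else 0ℚ
  inner : Fin m → ℚ
  inner k = maskedSum c' (λ k' → if ⌊ k ≟ k' ⌋ then 0ℚ else G' k k')
  shift : ∀ k → maskedSum c' (λ k' → if ⌊ fs k ≟ fs k' ⌋ then 0ℚ else G' k k') ≡ inner k
  shift k = maskedSum-cong c' λ k' _ → cong (λ b → if b then 0ℚ else G' k k') (⌊fs≟fs⌋ k k')
  regroup : ∀ b →
    (if b then (if b then 0ℚ else 0ℚ) + R else 0ℚ) + maskedSum c' (λ k → (if b then C k else 0ℚ) + inner k)
      ≡ (if b then maskedSum c' (λ k → G fz (fs k) + C k) else 0ℚ) + offDiagonalSum c' G'
  regroup false = cong (0ℚ +_) (maskedSum-cong c' λ k _ → +-identityˡ (inner k))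
  regroup true = begin
    (0ℚ + R) + maskedSum c' (λ k → C k + inner k)  ≡⟨ cong ((0ℚ + R) +_) (maskedSum-+ c' C inner) ⟩
    (0ℚ + R) + (maskedSum c' C + offDiagonalSum c' G')
      ≡⟨ solve 3 (λ r x d → (con 0ℚ :+ r) :+ (x :+ d) := (r :+ x) :+ d) refl R (maskedSum c' C) (offDiagonalSum c' G') ⟩
    (R + maskedSum c' C) + offDiagonalSum c' G'    ≡⟨ cong (_+ offDiagonalSum c' G') (maskedSum-+ c' (λ k → G fz (fs k)) C) ⟨
    maskedSum c' (λ k → G fz (fs k) + C k) + offDiagonalSum c' G' ∎

offDiagonalBound : ℕ → ℕ → ℚ
offDiagonalBound k s = fromℕ k + excess k + excess s

offDiagonalBound-suc : ∀ k s → (2ℚ - fromℕ k) + offDiagonalBound k s ≡ offDiagonalBound (suc k) s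
offDiagonalBound-suc k s = begin
  (2ℚ - fromℕ k) + offDiagonalBound k s
    ≡⟨ solve 3 (λ K e f → (con 2ℚ :- K) :+ (K :+ e :+ f) := (con 1ℚ :+ K) :+ (e :+ con 1ℚ :- K) :+ f)
         refl (fromℕ k) (excess k) (excess s) ⟩
  (1ℚ + fromℕ k) + (excess k + 1ℚ - fromℕ k) + excess s
    ≡⟨ cong (_+ excess s) (cong₂ _+_ (fromℕ-suc k) (excess-suc k)) ⟨
  offDiagonalBound (suc k) s ∎
  where open ≡-Reasoning

offDiagonalBound-suc-suc : ∀ k s →
  (2ℚ + 1ℚ - (fromℕ k + fromℕ s)) + offDiagonalBound k s ≡ offDiagonalBound (suc k) (suc s)
offDiagonalBound-suc-suc k s = begin
  (2ℚ + 1ℚ - (fromℕ k + fromℕ s)) + offDiagonalBound k s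
    ≡⟨ solve 4 (λ K S e f → (con 2ℚ :+ con 1ℚ :- (K :+ S)) :+ (K :+ e :+ f)
                         := (con 1ℚ :+ K) :+ (e :+ con 1ℚ :- K) :+ (f :+ con 1ℚ :- S))
         refl (fromℕ k) (fromℕ s) (excess k) (excess s) ⟩
  (1ℚ + fromℕ k) + (excess k + 1ℚ - fromℕ k) + (excess s + 1ℚ - fromℕ s)
    ≡⟨ cong₂ _+_ (cong₂ _+_ (fromℕ-suc k) (excess-suc k)) (excess-suc s) ⟨
  offDiagonalBound (suc k) (suc s) ∎
  where open ≡-Reasoning

-- Adding an index j₀ (b: j₀ is active, b': j₀ is tight, u: its row plus column) raises the
-- first sum by at most 2 + [b'] and the pair sum by at least k + [b']·s.
offDiagonal-step-≤ : ∀ {m} (b b' : Bool) (c' t' : Fin m → Bool) (a₀ A D : ℚ) (u : Fin m → ℚ) →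
  A - D ≤ offDiagonalBound (count c') (count (λ j → c' j ∧ t' j)) →
  (b ≡ true → a₀ ≤ 2ℚ + 𝟙 b') →
  (b ≡ true → ∀ j → c' j ≡ true → 1ℚ + 𝟙 (b' ∧ t' j) ≤ u j) →
  ((if b then a₀ else 0ℚ) + A) - ((if b then maskedSum c' u else 0ℚ) + D)
    ≤ offDiagonalBound ((if b then 1 else 0) ℕ.+ count c')
                       ((if b ∧ b' then 1 else 0) ℕ.+ count (λ j → c' j ∧ t' j))
offDiagonal-step-≤ false b' c' t' a₀ A D u ih _ _ =
  ≤-trans (≤-reflexive (cong₂ _-_ (+-identityˡ A) (+-identityˡ D))) ih
offDiagonal-step-≤ true false c' t' a₀ A D u ih a₀≤ u≥ = begin
  (a₀ + A) - (maskedSum c' u + D)         ≤⟨ sum-difference-≤ (a₀≤ refl) count≤ ih ⟩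
  (2ℚ - fromℕ (count c')) + offDiagonalBound (count c') s ≡⟨ offDiagonalBound-suc (count c') s ⟩
  offDiagonalBound (suc (count c')) s     ∎
  where
  open ≤-Reasoning
  s : ℕ
  s = count (λ j → c' j ∧ t' j)
  count≤ : fromℕ (count c') ≤ maskedSum c' u
  count≤ = subst (_≤ maskedSum c' u) (sumFin-𝟙 c') (maskedSum-mono c' (u≥ refl))
offDiagonal-step-≤ true true c' t' a₀ A D u ih a₀≤ u≥ = begin
  (a₀ + A) - (maskedSum c' u + D)         ≤⟨ sum-difference-≤ (a₀≤ refl) counts≤ ih ⟩
  (2ℚ + 1ℚ - (fromℕ k + fromℕ s)) + offDiagonalBound k s ≡⟨ offDiagonalBound-suc-suc k s ⟩
  offDiagonalBound (suc k) (suc s)        ∎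
  where
  open ≤-Reasoning
  k s : ℕ
  k = count c'
  s = count (λ j → c' j ∧ t' j)
  counts≤ : fromℕ k + fromℕ s ≤ maskedSum c' u
  counts≤ = begin
    fromℕ k + fromℕ s                              ≡⟨ cong₂ _+_ (sumFin-𝟙 c') (maskedSum-𝟙 c' t') ⟨
    maskedSum c' (λ _ → 1ℚ) + maskedSum c' (𝟙 ∘ t') ≡⟨ maskedSum-+ c' (λ _ → 1ℚ) (𝟙 ∘ t') ⟨
    maskedSum c' (λ j → 1ℚ + 𝟙 (t' j))            ≤⟨ maskedSum-mono c' (u≥ refl) ⟩
    maskedSum c' u                                 ∎

maskedSum-offDiagonalSum-≤ : ∀ {m} (c t : Fin m → Bool) (a : Fin m → ℚ) (G : Fin m → Fin m → ℚ) →
  (∀ j → c j ≡ true → a j ≤ 2ℚ + 𝟙 (t j)) →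
  (∀ j j' → j ≢ j' → c j ≡ true → c j' ≡ true → 1ℚ + 𝟙 (t j ∧ t j') ≤ G j j' + G j' j) →
  maskedSum c a - offDiagonalSum c G ≤ offDiagonalBound (count c) (count (λ j → c j ∧ t j))
maskedSum-offDiagonalSum-≤ {zero} c t a G _ _ = ≤-refl
maskedSum-offDiagonalSum-≤ {suc m} c t a G a≤ G≥ =
  ≤-trans (≤-reflexive (cong (λ z → maskedSum c a - z) (offDiagonalSum-suc c G)))
    (offDiagonal-step-≤ (c fz) (t fz) (c ∘ fs) (t ∘ fs) (a fz) _ _ _
      (maskedSum-offDiagonalSum-≤ (c ∘ fs) (t ∘ fs) (a ∘ fs) (λ k k' → G (fs k) (fs k'))
        (a≤ ∘ fs) (λ j j' j≢j' → G≥ (fs j) (fs j') (j≢j' ∘ suc-injective)))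
      (a≤ fz) (λ c₀ j → G≥ fz (fs j) (λ ()) c₀))

IsLinear : ∀ {n} → (Point n → ℚ) → Set
IsLinear π = ∀ l u v → π (λ i j → l * u i j + v i j) ≡ l * π u + π v

module _ {n : ℕ} where

  coordinate-linear : (i j : Fin n) → IsLinear (λ x → x i j)
  coordinate-linear i j l u v = refl

  zero-linear : IsLinear {n} (λ _ → 0ℚ)
  zero-linear l u v = solve 1 (λ l → con 0ℚ := l :* con 0ℚ :+ con 0ℚ) refl l

  add-linear : ∀ {π ρ : Point n → ℚ} → IsLinear π → IsLinear ρ → IsLinear (λ x → π x + ρ x)
  add-linear {π} {ρ} π-lin ρ-lin l u v = trans (cong₂ _+_ (π-lin l u v) (ρ-lin l u v))
    (solve 5 (λ l a b c d → (l :* a :+ b) :+ (l :* c :+ d) := l :* (a :+ c) :+ (b :+ d))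
      refl l (π u) (π v) (ρ u) (ρ v))

  sub-linear : ∀ {π ρ : Point n → ℚ} → IsLinear π → IsLinear ρ → IsLinear (λ x → π x - ρ x)
  sub-linear {π} {ρ} π-lin ρ-lin l u v = trans (cong₂ _-_ (π-lin l u v) (ρ-lin l u v))
    (solve 5 (λ l a b c d → (l :* a :+ b) :- (l :* c :+ d) := l :* (a :- c) :+ (b :- d))
      refl l (π u) (π v) (ρ u) (ρ v))

  if-linear : ∀ (b : Bool) {π ρ : Point n → ℚ} → IsLinear π → IsLinear ρ →
    IsLinear (λ x → if b then π x else ρ x)
  if-linear true  π-lin _ = π-lin
  if-linear false _ ρ-lin = ρ-lin

  sumFin-linear : ∀ {m} {π : Fin m → Point n → ℚ} → (∀ j → IsLinear (π j)) →
    IsLinear (λ x → sumFin (λ j → π j x))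
  sumFin-linear {π = π} π-lin l u v = begin
    sumFin (λ j → π j (λ i i' → l * u i i' + v i i')) ≡⟨ sumFin-cong (λ j → π-lin j l u v) ⟩
    sumFin (λ j → l * π j u + π j v)                  ≡⟨ sumFin-+ (λ j → l * π j u) (λ j → π j v) ⟩
    sumFin (λ j → l * π j u) + sumFin (λ j → π j v)   ≡⟨ cong (_+ sumFin (λ j → π j v)) (sumFin-*ˡ l (λ j → π j u)) ⟩
    l * sumFin (λ j → π j u) + sumFin (λ j → π j v)   ∎
    where open ≡-Reasoning

  maskedSum-linear : ∀ {m} (c : Fin m → Bool) {π : Fin m → Point n → ℚ} → (∀ j → IsLinear (π j)) →
    IsLinear (λ x → maskedSum c (λ j → π j x))
  maskedSum-linear c π-lin = sumFin-linear (λ j → if-linear (c j) (π-lin j) zero-linear)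

  linear-zero : ∀ {π : Point n → ℚ} → IsLinear π → π (λ _ _ → 0ℚ) ≡ 0ℚ
  linear-zero {π} π-lin = trans (π-lin (- 1ℚ) O O)
    (solve 1 (λ p → con (- 1ℚ) :* p :+ p := con 0ℚ) refl (π O))
    where
    O : Point n
    O _ _ = 0ℚ

  combination-≤ : ∀ {π : Point n → ℚ} {r : ℚ} → IsLinear π → (∀ W → π (charVec W) ≤ r) →
    ∀ ts → AllNonneg ts → π (combination ts) ≤ sumCoeffs ts * r
  combination-≤ {π} {r} π-lin _ [] [] = ≤-reflexive (trans (linear-zero π-lin) (sym (*-zeroˡ r)))
  combination-≤ {π} {r} π-lin vertex≤ ((l , W) ∷ ts) (0≤l ∷ nonneg) = begin
    π (combination ((l , W) ∷ ts))               ≡⟨ π-lin l (charVec W) (combination ts) ⟩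
    l * π (charVec W) + π (combination ts)
      ≤⟨ +-mono-≤ (*-monoˡ-≤-nonNeg l {{nonNegative 0≤l}} (vertex≤ W)) (combination-≤ π-lin vertex≤ ts nonneg) ⟩
    l * r + sumCoeffs ts * r                     ≡⟨ *-distribʳ-+ r l (sumCoeffs ts) ⟨
    (l + sumCoeffs ts) * r                       ∎
    where open ≤-Reasoning

  valid-from-vertices : ∀ {π : Point n → ℚ} {r : ℚ} → IsLinear π →
    (∀ {x y} → (∀ i j → i ≢ j → x i j ≡ y i j) → π x ≡ π y) →
    (∀ W → π (charVec W) ≤ r) → ValidFor n π r
  valid-from-vertices {π} {r} π-lin off-diagonal vertex≤ x (ts , nonneg , Σl≡1 , x≡) = begin
    π x                   ≡⟨ off-diagonal x≡ ⟩
    π (combination ts)    ≤⟨ combination-≤ π-lin vertex≤ ts nonneg ⟩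
    sumCoeffs ts * r      ≡⟨ cong (_* r) Σl≡1 ⟩
    1ℚ * r                ≡⟨ *-identityˡ r ⟩
    r                     ∎
    where open ≤-Reasoning

lhs7-linear : ∀ {n} (i₁ i₂ : Fin n) → IsLinear (lhs7 i₁ i₂)
lhs7-linear {n} i₁ i₂ =
  sub-linear
    (sub-linear
      (maskedSum-linear c λ j →
        add-linear (add-linear (coordinate-linear i₁ j) (coordinate-linear j i₁)) (coordinate-linear j i₂))
      (coordinate-linear i₁ i₂))
    (maskedSum-linear c λ j → maskedSum-linear c λ j' →
      if-linear ⌊ j ≟ j' ⌋ zero-linear (coordinate-linear j j'))
  where
  c : Fin n → Bool
  c = inComp i₁ i₂

inComp⇒≢ : ∀ {n} (i₁ i₂ j : Fin n) → inComp i₁ i₂ j ≡ true → j ≢ i₁ × j ≢ i₂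
inComp⇒≢ i₁ i₂ j h with j ≟ i₁ | j ≟ i₂
inComp⇒≢ i₁ i₂ j () | yes _ | _
inComp⇒≢ i₁ i₂ j () | no _  | yes _
inComp⇒≢ i₁ i₂ j h  | no j≢i₁ | no j≢i₂ = j≢i₁ , j≢i₂

lhs7-off-diagonal : ∀ {n} (i₁ i₂ : Fin n) → i₁ ≢ i₂ → ∀ {x y : Point n} →
  (∀ i j → i ≢ j → x i j ≡ y i j) → lhs7 i₁ i₂ x ≡ lhs7 i₁ i₂ y
lhs7-off-diagonal {n} i₁ i₂ i₁≢i₂ {x} {y} x≡y =
  cong₂ _-_ (cong₂ _-_ (maskedSum-cong c triple) (x≡y i₁ i₂ i₁≢i₂))
            (maskedSum-cong c λ j _ → maskedSum-cong c λ j' _ → entry j j')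
  where
  c : Fin n → Bool
  c = inComp i₁ i₂
  triple : ∀ j → c j ≡ true → x i₁ j + x j i₁ + x j i₂ ≡ y i₁ j + y j i₁ + y j i₂
  triple j cj with inComp⇒≢ i₁ i₂ j cj
  ... | j≢i₁ , j≢i₂ =
    cong₂ _+_ (cong₂ _+_ (x≡y i₁ j (j≢i₁ ∘ sym)) (x≡y j i₁ j≢i₁)) (x≡y j i₂ j≢i₂)
  entry : ∀ j j' → (if ⌊ j ≟ j' ⌋ then 0ℚ else x j j') ≡ (if ⌊ j ≟ j' ⌋ then 0ℚ else y j j')
  entry j j' with j ≟ j'
  ... | yes _    = refl
  ... | no j≢j' = x≡y j j' j≢j'

lhs7-vertex-≤ : ∀ {n} (i₁ i₂ : Fin n) (W : WeakOrder n) →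
  lhs7 i₁ i₂ (charVec W) ≤ fromℕ (count (inComp i₁ i₂)) + excess (count (inComp i₁ i₂))
lhs7-vertex-≤ {n} i₁ i₂ (W , isWeakOrder) =
  subtract-≤ {maskedSum c a} {offDiagonalSum c x} (maskedSum-offDiagonalSum-≤ c tight a x triple pair)
             (excess-count-≤ (λ j → c j ∧ tight j) (0≤𝟙 (W i₁ i₂)) tight⇒i₁≽i₂)
  where
  open IsWeakOrder isWeakOrder
  x : Point n
  x = charVec (W , isWeakOrder)
  c : Fin n → Bool
  c = inComp i₁ i₂
  a : Fin n → ℚ
  a j = x i₁ j + x j i₁ + x j i₂
  tight : Fin n → Bool
  tight j = W i₁ j ∧ W j i₁ ∧ W j i₂
  tight⇒ : ∀ j → tight j ≡ true → W i₁ j ≡ true × W j i₁ ≡ true × W j i₂ ≡ true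
  tight⇒ j h = ∧-conicalˡ (W i₁ j) _ h
             , ∧-conicalˡ (W j i₁) (W j i₂) (∧-conicalʳ (W i₁ j) _ h)
             , ∧-conicalʳ (W j i₁) (W j i₂) (∧-conicalʳ (W i₁ j) _ h)
  triple : ∀ j → c j ≡ true → a j ≤ 2ℚ + 𝟙 (tight j)
  triple j _ = 𝟙-triple-≤ (W i₁ j) (W j i₁) (W j i₂)
  tied : ∀ j j' → tight j ≡ true → tight j' ≡ true → W j j' ≡ true
  tied j j' tj tj' with tight⇒ j tj | tight⇒ j' tj'
  ... | _ , j≽i₁ , _ | i₁≽j' , _ = transitive j i₁ j' j≽i₁ i₁≽j'
  pair : ∀ j j' → j ≢ j' → c j ≡ true → c j' ≡ true → 1ℚ + 𝟙 (tight j ∧ tight j') ≤ x j j' + x j' j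
  pair j j' _ _ _ = 𝟙-pair-≤ (total j j') λ both →
    let tj = ∧-conicalˡ (tight j) (tight j') both
        tj' = ∧-conicalʳ (tight j) (tight j') both
    in tied j j' tj tj' , tied j' j tj' tj
  tight⇒i₁≽i₂ : ∀ j → c j ∧ tight j ≡ true → 1ℚ ≤ x i₁ i₂
  tight⇒i₁≽i₂ j h with tight⇒ j (∧-conicalʳ (c j) (tight j) h)
  ... | i₁≽j , _ , j≽i₂ = 1≤𝟙 (transitive i₁ j i₂ i₁≽j j≽i₂)

theorem7 : (n : ℕ) → n ℕ.≥ 4 → (i₁ i₂ : Fin n) → i₁ ≢ i₂ →
    ValidFor n (lhs7 i₁ i₂) (rhs7 n)
theorem7 n _ i₁ i₂ i₁≢i₂ =
  valid-from-vertices (lhs7-linear i₁ i₂) (lhs7-off-diagonal i₁ i₂ i₁≢i₂) vertex≤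
  where
  k : ℕ
  k = count (inComp i₁ i₂)
  bound≡rhs : fromℕ k + excess k ≡ rhs7 n
  bound≡rhs = trans (sym (rhs7-closed-form k)) (cong rhs7 (count-inComp i₁ i₂ i₁≢i₂))
  vertex≤ : ∀ W → lhs7 i₁ i₂ (charVec W) ≤ rhs7 n
  vertex≤ W = subst (lhs7 i₁ i₂ (charVec W) ≤_) bound≡rhs (lhs7-vertex-≤ i₁ i₂ W)
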